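{- Let $n$ be a positive integer, let $B_n=\{x_1,\ldots,x_n\}$ be the standard basis of $\mathbb{R}^n$, let $s_n=\sum_{i=1}^n x_i$, and let $D$ be a non-empty dissociated subset of $\{0,1\}^n$. Let $2\cdot D=\{2x:x\in D\}$. Then the set $A_n=B_n\cup\{s_n\}\cup(2\cdot D)$ satisfies $d_s(A_n)=n+1$ and $d_d^-(A_n)=d_d(A_n)=n+|D|$.
   Context: All sets are viewed as additive sets in the abelian group $\mathbb{R}^n$. A set $D$ is dissociated if its subset sums are pairwise distinct (equivalently, the only combination $\sum_{x\in D}\varepsilon_x x$ with $\varepsilon_x\in\{ -1,0,1\}$ equal to $0$ is the trivial one); $D\subset A$ is maximal dissociated in $A$ if no dissociated $D'\subset A$ strictly contains $D$. $d_d(A)=\max\{|D|:D\subset A\text{ dissociated}\}$, $d_d^-(A)=\min\{|D|:D\subset A\text{ maximal dissociated}\}$. The 1-span $\langle S\rangle$ is the set of all sums $\sum_{s\in S}\varepsilon_s s$ with $\varepsilon_s\in\{ -1,0,1\}$, and $d_s(A)=\min\{|S|:S\subset A,\ \langle S\rangle\supset A\}$. -}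

module Defs where

open import Data.Nat using (ℕ; _≤_)
open import Data.Integer using (ℤ; +_; -[1+_]; _+_; _*_)
open import Data.Fin using (Fin)
open import Data.Vec using (Vec; replicate; zipWith; map; tabulate; toList; _[_]≔_)
open import Data.List using (List; []; _∷_; foldr; length; _++_) renaming (map to lmap)
open import Data.List.Membership.Propositional using (_∈_)
open import Data.List.Relation.Unary.Unique.Propositional using (Unique)
open import Data.List.Relation.Unary.All using (All)
open import Data.Product using (Σ; _×_; ∃)
open import Relation.Binary.PropositionalEquality using (_≡_)

-- Points of ℝⁿ with integer coordinates (all sets in the statement live in ℤⁿ;
-- ±1-combinations of integer vectors are integer vectors, so nothing is lost).
Pt : ℕ → Set
Pt n = Vec ℤ n

0ᵥ : ∀ {n} → Pt n
0ᵥ {n} = replicate n (+ 0)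

_+ᵥ_ : ∀ {n} → Pt n → Pt n → Pt n
_+ᵥ_ = zipWith _+_

_·ᵥ_ : ∀ {n} → ℤ → Pt n → Pt n
c ·ᵥ v = map (c *_) v

data Coef : Set where
  neg zer pos : Coef

⟦_⟧ : Coef → ℤ
⟦ neg ⟧ = -[1+ 0 ]
⟦ zer ⟧ = + 0
⟦ pos ⟧ = + 1

-- Σ_{x ∈ S} ε_x x   (S a duplicate-free list, so indexing by elements is fine)
comb : ∀ {n} → (Pt n → Coef) → List (Pt n) → Pt n
comb ε = foldr (λ x acc → (⟦ ε x ⟧ ·ᵥ x) +ᵥ acc) 0ᵥ

-- finite subsets: duplicate-free lists; inclusion via membership
_⊆_ : ∀ {n} → List (Pt n) → List (Pt n) → Set
S ⊆ T = ∀ {x} → x ∈ S → x ∈ T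

SubsetOf : ∀ {n} → List (Pt n) → List (Pt n) → Set
SubsetOf A D = Unique D × (D ⊆ A)

Dissociated : ∀ {n} → List (Pt n) → Set
Dissociated {n} D = (ε : Pt n → Coef) → comb ε D ≡ 0ᵥ → ∀ {x} → x ∈ D → ε x ≡ zer

MaximalDissociated : ∀ {n} → List (Pt n) → List (Pt n) → Set
MaximalDissociated A D =
  SubsetOf A D × Dissociated D ×
  (∀ D' → SubsetOf A D' → Dissociated D' → D ⊆ D' → D' ⊆ D)

_∈⟨_⟩ : ∀ {n} → Pt n → List (Pt n) → Set
y ∈⟨ S ⟩ = ∃ λ ε → comb ε S ≡ y

Spans : ∀ {n} → List (Pt n) → List (Pt n) → Set
Spans S A = ∀ {y} → y ∈ A → y ∈⟨ S ⟩

DdIs : ∀ {n} → List (Pt n) → ℕ → Set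
DdIs A k =
  (Σ _ λ D → SubsetOf A D × Dissociated D × length D ≡ k) ×
  (∀ D → SubsetOf A D → Dissociated D → length D ≤ k)

DdMinusIs : ∀ {n} → List (Pt n) → ℕ → Set
DdMinusIs A k =
  (Σ _ λ D → MaximalDissociated A D × length D ≡ k) ×
  (∀ D → MaximalDissociated A D → k ≤ length D)

DsIs : ∀ {n} → List (Pt n) → ℕ → Set
DsIs A k =
  (Σ _ λ S → SubsetOf A S × Spans S A × length S ≡ k) ×
  (∀ S → SubsetOf A S → Spans S A → k ≤ length S)

e : ∀ {n} → Fin n → Pt n
e {n} i = replicate n (+ 0) [ i ]≔ + 1

basis : (n : ℕ) → List (Pt n)
basis n = toList (tabulate (e {n}))

sVec : (n : ℕ) → Pt n
sVec n = replicate n (+ 1)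

Aset : (n : ℕ) → List (Pt n) → List (Pt n)
Aset n D = basis n ++ (sVec n ∷ lmap (λ x → (+ 2) ·ᵥ x) D)

data Bit : ℤ → Set where
  b0 : Bit (+ 0)
  b1 : Bit (+ 1)

ZeroOne : ∀ {n} → Pt n → Set
ZeroOne v = Data.Vec.Relation.Unary.All.All Bit v
  where import Data.Vec.Relation.Unary.All

-- Write U = Bₙ ∪ {sₙ} and e₁, …, eₙ for the basis vectors. In a ±1-combination of
-- Aₙ with coefficients ε, the i-th coordinate is ε(eᵢ) + ε(sₙ) + 2yᵢ, where y is the
-- combination of D carrying the coefficients of 2·D. By parity, if the target is even
-- and some element of U has coefficient 0, then all of U has coefficient 0 and y is
-- half the target. Hence, for n ≥ 2, a subset of Aₙ is dissociated iff it misses an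
-- element of U (U itself satisfies sₙ − Σ eᵢ = 0), so the maximal dissociated subsets
-- are the Aₙ ∖ {u}, u ∈ U, all of size n + |D|. For x ∈ {0,1}ⁿ we have
-- 2x = sₙ + Σ (2xᵢ − 1) eᵢ, so U spans Aₙ; a spanning set missing some u ∈ U must
-- contain the rest of U and an element of 2·D, hence d_s(Aₙ) = n + 1.
-- For n = 1, s₁ = e₁ and D = {1}, so A₁ = {1, 2}.
module Submission where

open import Defs
open import Data.Nat using (ℕ; _+_; NonZero)
open import Data.List using (List; []; length)
open import Data.List.Relation.Unary.All using (All)
open import Data.List.Relation.Unary.Unique.Propositional using (Unique)
open import Data.Product using (_×_)
open import Relation.Binary.PropositionalEquality using (_≢_)

open import Data.Nat as ℕ using (zero; suc; _≤_; z≤n; s≤s)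
import Data.Nat.Properties as ℕP
open import Data.Integer as ℤ using (ℤ; +_; -[1+_]; ∣_∣)
import Data.Integer.Properties as ℤP
open import Data.Integer.Tactic.RingSolver using (solve-∀)
open import Data.Fin as Fin using (Fin)
open import Data.Vec as Vec using (_∷_; replicate; tabulate; toList; lookup)
import Data.Vec.Properties as VecP
import Data.Vec.Relation.Unary.All as VecAll
import Data.Vec.Relation.Unary.All.Properties as VecAllP
open import Data.List as List using (_∷_; _++_; filter) renaming (map to lmap)
import Data.List.Properties as ListP
open import Data.List.Membership.Propositional using (_∈_; _∉_; find; lose)
import Data.List.Membership.Propositional.Properties as ∈P
open import Data.List.Membership.Propositional.Properties.WithK using (unique∧set⇒bag)
open import Data.List.Relation.Unary.Any as Any using (here; there)
open import Data.List.Relation.Unary.All as All using ([]; _∷_)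
open import Data.List.Relation.Unary.All.Properties using (¬All⇒Any¬; ¬Any⇒All¬)
open import Data.List.Relation.Unary.AllPairs using ([]; _∷_)
import Data.List.Relation.Unary.Unique.Propositional.Properties as UniqueP
open import Data.List.Relation.Binary.BagAndSetEquality using (∼bag⇒↭)
open import Data.List.Relation.Binary.Permutation.Propositional as ↭ using (_↭_)
open import Data.List.Relation.Binary.Permutation.Propositional.Properties using (↭-length)
open import Data.Product using (∃; _,_; proj₁; proj₂)
open import Data.Sum using (_⊎_; inj₁; inj₂)
open import Data.Empty using (⊥; ⊥-elim)
open import Function using (_∘_)
open import Function.Bundles using (mk⇔)
open import Relation.Nullary using (¬_; Dec; yes; no; ¬?; contradiction)
open import Relation.Binary.Definitions using (DecidableEquality)
open import Relation.Binary.PropositionalEquality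
  using (_≡_; refl; sym; trans; cong; cong₂; subst; ≢-sym; module ≡-Reasoning)
open ≡-Reasoning

private variable
  n : ℕ
  f g : Pt n → Coef
  u v w x y z : Pt n
  L S T X Y : List (Pt n)
  i j k : Fin n

_≟ᵥ_ : DecidableEquality (Pt n)
_≟ᵥ_ = VecP.≡-dec ℤ._≟_

≡-by-lookup : (u v : Pt n) → (∀ k → lookup u k ≡ lookup v k) → u ≡ v
≡-by-lookup u v eq =
  trans (sym (VecP.tabulate∘lookup u)) (trans (VecP.tabulate-cong eq) (VecP.tabulate∘lookup v))

+ᵥ-identityˡ : (v : Pt n) → 0ᵥ +ᵥ v ≡ v
+ᵥ-identityˡ = VecP.zipWith-identityˡ ℤP.+-identityˡ

+ᵥ-identityʳ : (v : Pt n) → v +ᵥ 0ᵥ ≡ v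
+ᵥ-identityʳ = VecP.zipWith-identityʳ ℤP.+-identityʳ

+ᵥ-assoc : (u v w : Pt n) → (u +ᵥ v) +ᵥ w ≡ u +ᵥ (v +ᵥ w)
+ᵥ-assoc = VecP.zipWith-assoc ℤP.+-assoc

+ᵥ-swap : (u v w : Pt n) → u +ᵥ (v +ᵥ w) ≡ v +ᵥ (u +ᵥ w)
+ᵥ-swap u v w = begin
  u +ᵥ (v +ᵥ w)  ≡⟨ +ᵥ-assoc u v w ⟨
  (u +ᵥ v) +ᵥ w  ≡⟨ cong (_+ᵥ w) (VecP.zipWith-comm ℤP.+-comm u v) ⟩
  (v +ᵥ u) +ᵥ w  ≡⟨ +ᵥ-assoc v u w ⟩
  v +ᵥ (u +ᵥ w)  ∎

·ᵥ-zeroˡ : (v : Pt n) → (+ 0) ·ᵥ v ≡ 0ᵥ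
·ᵥ-zeroˡ v = trans (VecP.map-cong ℤP.*-zeroˡ v) (VecP.map-const v (+ 0))

·ᵥ-zeroʳ : (c : ℤ) → c ·ᵥ 0ᵥ {n} ≡ 0ᵥ
·ᵥ-zeroʳ {n} c = trans (VecP.map-replicate (c ℤ.*_) (+ 0) n) (cong (replicate n) (ℤP.*-zeroʳ c))

·ᵥ-identityˡ : (v : Pt n) → (+ 1) ·ᵥ v ≡ v
·ᵥ-identityˡ v = trans (VecP.map-cong ℤP.*-identityˡ v) (VecP.map-id v)

·ᵥ-comm : (c d : ℤ) (v : Pt n) → c ·ᵥ (d ·ᵥ v) ≡ d ·ᵥ (c ·ᵥ v)
·ᵥ-comm c d Vec.[] = refl
·ᵥ-comm c d (a ∷ v) = cong₂ _∷_ (*-swap c d a) (·ᵥ-comm c d v)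
  where
  *-swap : ∀ c d a → c ℤ.* (d ℤ.* a) ≡ d ℤ.* (c ℤ.* a)
  *-swap = solve-∀

·ᵥ-distribˡ : (c : ℤ) (u v : Pt n) → c ·ᵥ (u +ᵥ v) ≡ (c ·ᵥ u) +ᵥ (c ·ᵥ v)
·ᵥ-distribˡ c Vec.[] Vec.[] = refl
·ᵥ-distribˡ c (a ∷ u) (b ∷ v) = cong₂ _∷_ (ℤP.*-distribˡ-+ c a b) (·ᵥ-distribˡ c u v)

lookup-+ᵥ : (u v : Pt n) (k : Fin n) → lookup (u +ᵥ v) k ≡ lookup u k ℤ.+ lookup v k
lookup-+ᵥ u v k = VecP.lookup-zipWith ℤ._+_ k u v

lookup-·ᵥ : (c : ℤ) (u : Pt n) (k : Fin n) → lookup (c ·ᵥ u) k ≡ c ℤ.* lookup u k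
lookup-·ᵥ c u k = VecP.lookup-map k (c ℤ.*_) u

comb-++ : (f : Pt n → Coef) (X Y : List (Pt n)) → comb f (X ++ Y) ≡ comb f X +ᵥ comb f Y
comb-++ f [] Y = sym (+ᵥ-identityˡ _)
comb-++ f (x ∷ X) Y = trans (cong (_ +ᵥ_) (comb-++ f X Y)) (sym (+ᵥ-assoc _ _ _))

comb-↭ : (f : Pt n → Coef) → X ↭ Y → comb f X ≡ comb f Y
comb-↭ f ↭.refl = refl
comb-↭ f (↭.prep x p) = cong (_ +ᵥ_) (comb-↭ f p)
comb-↭ f (↭.swap x y p) = trans (cong (λ r → _ +ᵥ (_ +ᵥ r)) (comb-↭ f p)) (+ᵥ-swap _ _ _)
comb-↭ f (↭.trans p q) = trans (comb-↭ f p) (comb-↭ f q)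

comb-zer : (∀ {z} → z ∈ L → f z ≡ zer) → comb f L ≡ 0ᵥ
comb-zer {L = []} _ = refl
comb-zer {L = x ∷ L} {f} f≡zer = begin
  (⟦ f x ⟧ ·ᵥ x) +ᵥ comb f L
    ≡⟨ cong₂ _+ᵥ_ (cong (λ a → ⟦ a ⟧ ·ᵥ x) (f≡zer (here refl))) (comb-zer (f≡zer ∘ there)) ⟩
  ((+ 0) ·ᵥ x) +ᵥ 0ᵥ  ≡⟨ +ᵥ-identityʳ _ ⟩
  (+ 0) ·ᵥ x          ≡⟨ ·ᵥ-zeroˡ x ⟩
  0ᵥ                  ∎

_∈?_ : (x : Pt n) (L : List (Pt n)) → Dec (x ∈ L)
x ∈? L = Any.any? (x ≟ᵥ_) L

⊆∧⊇⇒↭ : Unique X → Unique Y → X ⊆ Y → Y ⊆ X → X ↭ Y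
⊆∧⊇⇒↭ X-unique Y-unique X⊆Y Y⊆X =
  ∼bag⇒↭ (unique∧set⇒bag X-unique Y-unique (mk⇔ X⊆Y Y⊆X))

filter-∈-↭ : Unique X → Unique Y → X ⊆ Y → filter (_∈? X) Y ↭ X
filter-∈-↭ {X = X} {Y = Y} X-unique Y-unique X⊆Y =
  ⊆∧⊇⇒↭ (UniqueP.filter⁺ (_∈? X) Y-unique) X-unique
    (λ p → proj₂ (∈P.∈-filter⁻ (_∈? X) {xs = Y} p))
    (λ p → ∈P.∈-filter⁺ (_∈? X) (X⊆Y p) p)

⊆⇒length≤ : Unique X → Unique Y → X ⊆ Y → length X ≤ length Y
⊆⇒length≤ {X = X} {Y = Y} X-unique Y-unique X⊆Y =
  subst (_≤ length Y) (↭-length (filter-∈-↭ X-unique Y-unique X⊆Y))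
    (ListP.length-filter (_∈? X) Y)

infixl 6 _─_
_─_ : List (Pt n) → Pt n → List (Pt n)
L ─ u = filter (λ z → ¬? (z ≟ᵥ u)) L

∈-─⁺ : z ∈ L → z ≢ u → z ∈ L ─ u
∈-─⁺ {u = u} = ∈P.∈-filter⁺ (λ z → ¬? (z ≟ᵥ u))

∈-─⁻ : z ∈ L ─ u → z ∈ L × z ≢ u
∈-─⁻ {u = u} = ∈P.∈-filter⁻ (λ z → ¬? (z ≟ᵥ u))

─-unique : Unique L → Unique (L ─ u)
─-unique {u = u} = UniqueP.filter⁺ (λ z → ¬? (z ≟ᵥ u))

⊆-─ : T ⊆ L → u ∉ T → T ⊆ (L ─ u)
⊆-─ {T = T} T⊆L u∉T z∈T = ∈-─⁺ (T⊆L z∈T) (λ z≡u → u∉T (subst (_∈ T) z≡u z∈T))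

length-─ : Unique L → u ∈ L → suc (length (L ─ u)) ≡ length L
length-─ {L = L} {u} L-unique u∈L =
  ↭-length (⊆∧⊇⇒↭ u∷L─u-unique L-unique into onto)
  where
  u∷L─u-unique : Unique (u ∷ L ─ u)
  u∷L─u-unique =
    All.tabulate (λ p → ≢-sym (proj₂ (∈-─⁻ {L = L} p))) ∷ ─-unique L-unique
  into : (u ∷ L ─ u) ⊆ L
  into (here refl) = u∈L
  into (there p) = proj₁ (∈-─⁻ p)
  onto : L ⊆ (u ∷ L ─ u)
  onto {z} z∈L with z ≟ᵥ u
  ... | yes refl = here refl
  ... | no z≢u = there (∈-─⁺ z∈L z≢u)

mask : List (Pt n) → (Pt n → Coef) → Pt n → Coef
mask T f z with z ∈? T
... | yes _ = f z
... | no _ = zer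

mask-∈ : z ∈ T → mask T f z ≡ f z
mask-∈ {z = z} {T} z∈T with z ∈? T
... | yes _ = refl
... | no z∉T = contradiction z∈T z∉T

mask-∉ : z ∉ T → mask T f z ≡ zer
mask-∉ {z = z} {T} z∉T with z ∈? T
... | yes z∈T = contradiction z∈T z∉T
... | no _ = refl

comb-mask≡comb-filter : (T L : List (Pt n)) → comb (mask T f) L ≡ comb f (filter (_∈? T) L)
comb-mask≡comb-filter T [] = refl
comb-mask≡comb-filter {f = f} T (x ∷ L) with x ∈? T
... | yes _ = cong (_ +ᵥ_) (comb-mask≡comb-filter T L)
... | no _ = trans (cong₂ _+ᵥ_ (·ᵥ-zeroˡ x) (comb-mask≡comb-filter T L)) (+ᵥ-identityˡ _)

comb-mask : Unique T → Unique L → T ⊆ L → comb (mask T f) L ≡ comb f T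
comb-mask {T = T} {L} {f} T-unique L-unique T⊆L =
  trans (comb-mask≡comb-filter T L) (comb-↭ f (filter-∈-↭ T-unique L-unique T⊆L))

indicator : Pt n → Pt n → Coef
indicator y = mask (y ∷ []) (λ _ → pos)

comb-indicator : Unique L → y ∈ L → comb (indicator y) L ≡ y
comb-indicator L-unique y∈L =
  trans (comb-mask ([] ∷ []) L-unique (λ { (here refl) → y∈L }))
        (trans (+ᵥ-identityʳ _) (·ᵥ-identityˡ _))

indicator-self : (y : Pt n) → indicator y y ≡ pos
indicator-self y = mask-∈ {T = y ∷ []} (here refl)

∈⇒∈⟨⟩ : Unique L → y ∈ L → y ∈⟨ L ⟩
∈⇒∈⟨⟩ {y = y} L-unique y∈L = indicator y , comb-indicator L-unique y∈L

0ᵥ∉dissociated : Unique L → Dissociated L → 0ᵥ ∉ L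
0ᵥ∉dissociated {n} L-unique L-dissociated 0ᵥ∈L =
  contradiction (trans (sym (indicator-self (0ᵥ {n})))
                       (L-dissociated (indicator 0ᵥ) (comb-indicator L-unique 0ᵥ∈L) 0ᵥ∈L))
                λ ()

e-diagonal : (i : Fin n) → lookup (e i) i ≡ + 1
e-diagonal {n} i = VecP.lookup∘update i (replicate n (+ 0)) (+ 1)

e-offdiagonal : i ≢ j → lookup (e i) j ≡ + 0
e-offdiagonal {n} {i} {j} i≢j =
  trans (VecP.lookup∘update′ (≢-sym i≢j) (replicate n (+ 0)) (+ 1))
        (VecP.lookup-replicate j (+ 0))

e-injective : e i ≡ e j → i ≡ j
e-injective {i = i} {j} eᵢ≡eⱼ with i Fin.≟ j
... | yes i≡j = i≡j
... | no i≢j = contradiction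
  (trans (sym (e-diagonal i))
         (trans (cong (λ v → lookup v i) eᵢ≡eⱼ) (e-offdiagonal (≢-sym i≢j))))
  λ ()

lookup-sVec : (k : Fin n) → lookup (sVec n) k ≡ + 1
lookup-sVec k = VecP.lookup-replicate k (+ 1)

sVec≢e : i ≢ k → sVec n ≢ e i
sVec≢e {k = k} i≢k s≡eᵢ = contradiction
  (trans (sym (lookup-sVec k)) (trans (cong (λ v → lookup v k) s≡eᵢ) (e-offdiagonal i≢k)))
  λ ()

toList∘tabulate : ∀ {m} {A : Set} (h : Fin m → A) → toList (tabulate h) ≡ List.tabulate h
toList∘tabulate {zero} h = refl
toList∘tabulate {suc m} h = cong (h Fin.zero ∷_) (toList∘tabulate (h ∘ Fin.suc))

∈-basis⁺ : (i : Fin n) → e i ∈ basis n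
∈-basis⁺ {n} i = subst (e i ∈_) (sym (toList∘tabulate (e {n}))) (∈P.∈-tabulate⁺ i)

∈-basis⁻ : y ∈ basis n → ∃ λ i → y ≡ e i
∈-basis⁻ {n = n} p = ∈P.∈-tabulate⁻ (subst (_ ∈_) (toList∘tabulate (e {n})) p)

basis-unique : Unique (basis n)
basis-unique {n} = subst Unique (sym (toList∘tabulate (e {n}))) (UniqueP.tabulate⁺ e-injective)

length-basis : length (basis n) ≡ n
length-basis {n} = trans (cong length (toList∘tabulate (e {n}))) (ListP.length-tabulate e)

-- e (suc i) is definitionally + 0 ∷ e i.
basis-suc : basis (suc n) ≡ e Fin.zero ∷ lmap (+ 0 ∷_) (basis n)
basis-suc {n} = cong (e Fin.zero ∷_)
  (trans (cong toList (VecP.tabulate-∘ (+ 0 ∷_) (e {n})))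
         (VecP.toList-map (+ 0 ∷_) (tabulate e)))

comb-prepend-0 : (g : Pt (suc n) → Coef) (L : List (Pt n)) →
  comb g (lmap (+ 0 ∷_) L) ≡ + 0 ∷ comb (g ∘ (+ 0 ∷_)) L
comb-prepend-0 g [] = refl
comb-prepend-0 g (x ∷ L) =
  cong₂ _+ᵥ_ (cong₂ _∷_ (ℤP.*-zeroʳ ⟦ g (+ 0 ∷ x) ⟧) refl) (comb-prepend-0 g L)

comb-basis : (g : Pt n → Coef) → comb g (basis n) ≡ tabulate (λ i → ⟦ g (e i) ⟧)
comb-basis {zero} g = refl
comb-basis {suc n} g = begin
  comb g (basis (suc n))
    ≡⟨ cong (comb g) basis-suc ⟩
  (c ·ᵥ e Fin.zero) +ᵥ comb g (lmap (+ 0 ∷_) (basis n))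
    ≡⟨ cong ((c ·ᵥ e Fin.zero) +ᵥ_) (comb-prepend-0 g (basis n)) ⟩
  (c ℤ.* + 1 ℤ.+ + 0) ∷ ((c ·ᵥ 0ᵥ) +ᵥ comb (g ∘ (+ 0 ∷_)) (basis n))
    ≡⟨ cong₂ _∷_ (trans (ℤP.+-identityʳ _) (ℤP.*-identityʳ c))
                 (trans (cong (_+ᵥ comb (g ∘ (+ 0 ∷_)) (basis n)) (·ᵥ-zeroʳ c)) (+ᵥ-identityˡ _)) ⟩
  c ∷ comb (g ∘ (+ 0 ∷_)) (basis n)
    ≡⟨ cong (c ∷_) (comb-basis (g ∘ (+ 0 ∷_))) ⟩
  tabulate (λ i → ⟦ g (e i) ⟧) ∎
  where
  c : ℤ
  c = ⟦ g (e Fin.zero) ⟧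

lookup-comb-basis : (g : Pt n → Coef) (k : Fin n) → lookup (comb g (basis n)) k ≡ ⟦ g (e k) ⟧
lookup-comb-basis g k =
  trans (cong (λ v → lookup v k) (comb-basis g)) (VecP.lookup∘tabulate (λ i → ⟦ g (e i) ⟧) k)

dbl : Pt n → Pt n
dbl x = (+ 2) ·ᵥ x

lookup-dbl : (x : Pt n) (k : Fin n) → lookup (dbl x) k ≡ + 2 ℤ.* lookup x k
lookup-dbl x k = lookup-·ᵥ (+ 2) x k

dbl-injective : dbl x ≡ dbl y → x ≡ y
dbl-injective {x = x} {y} 2x≡2y = ≡-by-lookup x y λ k → ℤP.*-cancelˡ-≡ (+ 2) _ _ (begin
  + 2 ℤ.* lookup x k  ≡⟨ lookup-dbl x k ⟨
  lookup (dbl x) k    ≡⟨ cong (λ v → lookup v k) 2x≡2y ⟩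
  lookup (dbl y) k    ≡⟨ lookup-dbl y k ⟩
  + 2 ℤ.* lookup y k  ∎)

comb-map-dbl : (g : Pt n → Coef) (L : List (Pt n)) →
  comb g (lmap dbl L) ≡ dbl (comb (g ∘ dbl) L)
comb-map-dbl g [] = sym (·ᵥ-zeroʳ (+ 2))
comb-map-dbl g (x ∷ L) =
  trans (cong₂ _+ᵥ_ (·ᵥ-comm ⟦ g (dbl x) ⟧ (+ 2) x) (comb-map-dbl g L))
        (sym (·ᵥ-distribˡ (+ 2) _ _))

odd≢even : ∀ y z → + 1 ℤ.+ + 2 ℤ.* y ≢ + 2 ℤ.* z
odd≢even y z 1+2y≡2z = ℕP.even≢odd ∣ z ℤ.- y ∣ 0 (begin
  2 ℕ.* ∣ z ℤ.- y ∣             ≡⟨ ℤP.abs-* (+ 2) (z ℤ.- y) ⟨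
  ∣ + 2 ℤ.* (z ℤ.- y) ∣         ≡⟨ cong ∣_∣ (distrib z y) ⟩
  ∣ + 2 ℤ.* z ℤ.- + 2 ℤ.* y ∣   ≡⟨ cong (λ t → ∣ t ℤ.- + 2 ℤ.* y ∣) 1+2y≡2z ⟨
  ∣ (+ 1 ℤ.+ + 2 ℤ.* y) ℤ.- + 2 ℤ.* y ∣ ≡⟨ cong ∣_∣ (cancel y) ⟩
  1                             ∎)
  where
  distrib : ∀ z y → + 2 ℤ.* (z ℤ.- y) ≡ + 2 ℤ.* z ℤ.- + 2 ℤ.* y
  distrib = solve-∀
  cancel : ∀ y → (+ 1 ℤ.+ + 2 ℤ.* y) ℤ.- + 2 ℤ.* y ≡ + 1
  cancel = solve-∀

parity-cancelʳ : ∀ a c y z → ⟦ a ⟧ ℤ.+ ⟦ c ⟧ ℤ.+ + 2 ℤ.* y ≡ + 2 ℤ.* z →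
  c ≡ zer → a ≡ zer × y ≡ z
parity-cancelʳ zer _ y z eq refl =
  refl , ℤP.*-cancelˡ-≡ (+ 2) y z (trans (sym (ℤP.+-identityˡ _)) eq)
parity-cancelʳ pos _ y z eq refl = ⊥-elim (odd≢even y z eq)
parity-cancelʳ neg _ y z eq refl = ⊥-elim (odd≢even z y (begin
  + 1 ℤ.+ + 2 ℤ.* z                     ≡⟨ cong (ℤ._+_ (+ 1)) eq ⟨
  + 1 ℤ.+ (-[1+ 0 ] ℤ.+ + 2 ℤ.* y)      ≡⟨ ℤP.+-assoc (+ 1) -[1+ 0 ] (+ 2 ℤ.* y) ⟨
  + 0 ℤ.+ + 2 ℤ.* y                     ≡⟨ ℤP.+-identityˡ _ ⟩
  + 2 ℤ.* y                             ∎))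

parity-cancelˡ : ∀ a c y z → ⟦ a ⟧ ℤ.+ ⟦ c ⟧ ℤ.+ + 2 ℤ.* y ≡ + 2 ℤ.* z →
  a ≡ zer → c ≡ zer × y ≡ z
parity-cancelˡ a c y z eq =
  parity-cancelʳ c a y z (trans (cong (ℤ._+ + 2 ℤ.* y) (ℤP.+-comm ⟦ c ⟧ ⟦ a ⟧)) eq)

parity-odd : ∀ a c y → ⟦ a ⟧ ℤ.+ ⟦ c ⟧ ℤ.+ + 2 ℤ.* y ≡ + 1 → a ≡ zer → c ≢ zer
parity-odd _ _ y eq refl refl = odd≢even (+ 0) y (sym (trans (sym (ℤP.+-identityˡ _)) eq))

bit≢1⇒0 : ∀ {b} → Bit b → b ≢ + 1 → b ≡ + 0
bit≢1⇒0 b0 _ = refl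
bit≢1⇒0 b1 b≢1 = contradiction refl b≢1

double-bit≢1 : ∀ {b} → Bit b → + 2 ℤ.* b ≢ + 1
double-bit≢1 b0 ()
double-bit≢1 b1 ()

lookup-dbl-bits≢1 : ZeroOne x → (k : Fin n) → lookup (dbl x) k ≢ + 1
lookup-dbl-bits≢1 {x = x} x-bits k 2xₖ≡1 =
  double-bit≢1 (VecAllP.lookup⁺ x-bits k) (trans (sym (lookup-dbl x k)) 2xₖ≡1)

0ᵥ-bits : ZeroOne (0ᵥ {n})
0ᵥ-bits {zero} = VecAll.[]
0ᵥ-bits {suc n} = b0 VecAll.∷ 0ᵥ-bits

dot : Pt n → Pt n → ℤ
dot Vec.[] Vec.[] = + 0
dot (a ∷ x) (b ∷ y) = a ℤ.* b ℤ.+ dot x y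

dot-0ᵥ : (x : Pt n) → dot x 0ᵥ ≡ + 0
dot-0ᵥ Vec.[] = refl
dot-0ᵥ (a ∷ x) = cong₂ ℤ._+_ (ℤP.*-zeroʳ a) (dot-0ᵥ x)

dot-e : (x : Pt n) (i : Fin n) → dot x (e i) ≡ lookup x i
dot-e (a ∷ x) Fin.zero =
  trans (cong₂ ℤ._+_ (ℤP.*-identityʳ a) (dot-0ᵥ x)) (ℤP.+-identityʳ a)
dot-e (a ∷ x) (Fin.suc i) =
  trans (cong₂ ℤ._+_ (ℤP.*-zeroʳ a) (dot-e x i)) (ℤP.+-identityˡ _)

-- The case n ≥ 2, witnessed by two distinct indices

module Dimension≥2 {n : ℕ} (i₀ j₀ : Fin n) (i₀≢j₀ : i₀ ≢ j₀)
  {D : List (Pt n)} (D-unique : Unique D) (D-bits : All ZeroOne D)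
  (D-dissociated : Dissociated D) {x₀ : Pt n} (x₀∈D : x₀ ∈ D) where

  s : Pt n
  s = sVec n

  U : List (Pt n)
  U = basis n ++ s ∷ []

  D₂ : List (Pt n)
  D₂ = lmap dbl D

  A : List (Pt n)
  A = Aset n D

  data InU : Pt n → Set where
    sum  : InU s
    unit : (i : Fin n) → InU (e i)

  s∉basis : s ∉ basis n
  s∉basis p with ∈-basis⁻ p
  ... | i , s≡eᵢ with i Fin.≟ i₀
  ...   | yes refl = sVec≢e i₀≢j₀ s≡eᵢ
  ...   | no i≢i₀ = sVec≢e i≢i₀ s≡eᵢ

  ∈U-view : u ∈ U → InU u
  ∈U-view u∈U with ∈P.∈-++⁻ (basis n) u∈U
  ... | inj₂ (here refl) = sum
  ... | inj₁ u∈basis with ∈-basis⁻ u∈basis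
  ...   | i , refl = unit i

  s∈U : s ∈ U
  s∈U = ∈P.∈-++⁺ʳ (basis n) (here refl)

  e∈U : (i : Fin n) → e i ∈ U
  e∈U i = ∈P.∈-++⁺ˡ (∈-basis⁺ i)

  U-unique : Unique U
  U-unique = UniqueP.++⁺ basis-unique ([] ∷ []) λ { (p , here refl) → s∉basis p }

  length-U : length U ≡ n + 1
  length-U = trans (ListP.length-++ (basis n)) (cong (_+ 1) length-basis)

  dbl∉U : x ∈ D → dbl x ∉ U
  dbl∉U {x} x∈D 2x∈U = not-in-U (∈U-view 2x∈U) refl
    where
    x-bits : ZeroOne x
    x-bits = All.lookup D-bits x∈D
    not-in-U : InU u → dbl x ≢ u
    not-in-U sum 2x≡s = lookup-dbl-bits≢1 x-bits i₀
      (trans (cong (λ v → lookup v i₀) 2x≡s) (lookup-sVec i₀))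
    not-in-U (unit i) 2x≡eᵢ = lookup-dbl-bits≢1 x-bits i
      (trans (cong (λ v → lookup v i) 2x≡eᵢ) (e-diagonal i))

  A≡U++D₂ : A ≡ U ++ D₂
  A≡U++D₂ = sym (ListP.++-assoc (basis n) (s ∷ []) D₂)

  ∈A⁻ : z ∈ A → z ∈ U ⊎ z ∈ D₂
  ∈A⁻ z∈A = ∈P.∈-++⁻ U (subst (_ ∈_) A≡U++D₂ z∈A)

  U⊆A : U ⊆ A
  U⊆A z∈U = subst (_ ∈_) (sym A≡U++D₂) (∈P.∈-++⁺ˡ z∈U)

  dbl∈A : x ∈ D → dbl x ∈ A
  dbl∈A x∈D = subst (_ ∈_) (sym A≡U++D₂) (∈P.∈-++⁺ʳ U (∈P.∈-map⁺ dbl x∈D))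

  A-unique : Unique A
  A-unique = subst Unique (sym A≡U++D₂)
    (UniqueP.++⁺ U-unique (UniqueP.map⁺ dbl-injective D-unique) disjoint)
    where
    disjoint : ∀ {z} → ¬ (z ∈ U × z ∈ D₂)
    disjoint (z∈U , z∈D₂) with ∈P.∈-map⁻ dbl z∈D₂
    ... | x , x∈D , refl = dbl∉U x∈D z∈U

  A─u-subset : SubsetOf A (A ─ u)
  A─u-subset = ─-unique A-unique , λ p → proj₁ (∈-─⁻ p)

  length-A─u : u ∈ U → length (A ─ u) ≡ n + length D
  length-A─u {u} u∈U = ℕP.suc-injective (begin
    suc (length (A ─ u))      ≡⟨ length-─ A-unique (U⊆A u∈U) ⟩
    length A                  ≡⟨ cong length A≡U++D₂ ⟩
    length (U ++ D₂)          ≡⟨ ListP.length-++ U ⟩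
    length U + length D₂      ≡⟨ cong₂ _+_ length-U (ListP.length-map dbl D) ⟩
    n + 1 + length D          ≡⟨ ℕP.+-assoc n 1 (length D) ⟩
    n + suc (length D)        ≡⟨ ℕP.+-suc n (length D) ⟩
    suc (n + length D)        ∎)

  lookup-comb-U : (g : Pt n → Coef) (k : Fin n) →
    lookup (comb g U) k ≡ ⟦ g (e k) ⟧ ℤ.+ ⟦ g s ⟧
  lookup-comb-U g k = begin
    lookup (comb g U) k
      ≡⟨ cong (λ v → lookup v k) (comb-++ g (basis n) (s ∷ [])) ⟩
    lookup (comb g (basis n) +ᵥ ((⟦ g s ⟧ ·ᵥ s) +ᵥ 0ᵥ)) k
      ≡⟨ lookup-+ᵥ (comb g (basis n)) _ k ⟩
    lookup (comb g (basis n)) k ℤ.+ lookup ((⟦ g s ⟧ ·ᵥ s) +ᵥ 0ᵥ) k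
      ≡⟨ cong₂ ℤ._+_ (lookup-comb-basis g k)
                     (cong (λ v → lookup v k) (+ᵥ-identityʳ (⟦ g s ⟧ ·ᵥ s))) ⟩
    ⟦ g (e k) ⟧ ℤ.+ lookup (⟦ g s ⟧ ·ᵥ s) k
      ≡⟨ cong (ℤ._+_ ⟦ g (e k) ⟧)
              (trans (lookup-·ᵥ ⟦ g s ⟧ s k) (cong (ℤ._*_ ⟦ g s ⟧) (lookup-sVec k))) ⟩
    ⟦ g (e k) ⟧ ℤ.+ ⟦ g s ⟧ ℤ.* + 1
      ≡⟨ cong (ℤ._+_ ⟦ g (e k) ⟧) (ℤP.*-identityʳ ⟦ g s ⟧) ⟩
    ⟦ g (e k) ⟧ ℤ.+ ⟦ g s ⟧ ∎

  coordinates : (g : Pt n → Coef) → comb g A ≡ y → (k : Fin n) →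
    ⟦ g (e k) ⟧ ℤ.+ ⟦ g s ⟧ ℤ.+ + 2 ℤ.* lookup (comb (g ∘ dbl) D) k ≡ lookup y k
  coordinates {y = y} g g-rep k = begin
    ⟦ g (e k) ⟧ ℤ.+ ⟦ g s ⟧ ℤ.+ + 2 ℤ.* lookup (comb (g ∘ dbl) D) k
      ≡⟨ cong₂ ℤ._+_ (lookup-comb-U g k) (lookup-dbl (comb (g ∘ dbl) D) k) ⟨
    lookup (comb g U) k ℤ.+ lookup (dbl (comb (g ∘ dbl) D)) k
      ≡⟨ cong (λ v → lookup (comb g U) k ℤ.+ lookup v k) (comb-map-dbl g D) ⟨
    lookup (comb g U) k ℤ.+ lookup (comb g D₂) k
      ≡⟨ lookup-+ᵥ (comb g U) (comb g D₂) k ⟨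
    lookup (comb g U +ᵥ comb g D₂) k
      ≡⟨ cong (λ v → lookup v k) (comb-++ g U D₂) ⟨
    lookup (comb g (U ++ D₂)) k
      ≡⟨ cong (λ L → lookup (comb g L) k) A≡U++D₂ ⟨
    lookup (comb g A) k
      ≡⟨ cong (λ v → lookup v k) g-rep ⟩
    lookup y k ∎

  s-coefficient-zero : ∀ {t} (g : Pt n → Coef) → comb g A ≡ y →
    g (e k) ≡ zer → lookup y k ≡ + 2 ℤ.* t → g s ≡ zer
  s-coefficient-zero {k = k} {t} g g-rep gₖ≡zer yₖ≡2t =
    proj₁ (parity-cancelˡ _ _ _ t (trans (coordinates g g-rep k) yₖ≡2t) gₖ≡zer)

  even-representation : (g : Pt n → Coef) → comb g A ≡ dbl w → u ∈ U → g u ≡ zer →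
    (∀ {v} → v ∈ U → g v ≡ zer) × comb (g ∘ dbl) D ≡ w
  even-representation {w = w} {u = u} g g-rep u∈U gᵤ≡zer =
    U-coefficients , ≡-by-lookup _ w (λ k → proj₂ (unit-coefficient k))
    where
    even : ∀ k → lookup (dbl w) k ≡ + 2 ℤ.* lookup w k
    even = lookup-dbl w
    gₛ≡zer : g s ≡ zer
    gₛ≡zer = from-view (∈U-view u∈U) gᵤ≡zer
      where
      from-view : InU v → g v ≡ zer → g s ≡ zer
      from-view sum gₛ≡zer = gₛ≡zer
      from-view (unit k) gₖ≡zer = s-coefficient-zero g g-rep gₖ≡zer (even k)
    unit-coefficient : ∀ k → g (e k) ≡ zer × lookup (comb (g ∘ dbl) D) k ≡ lookup w k
    unit-coefficient k = parity-cancelʳ _ _ _ _ (trans (coordinates g g-rep k) (even k)) gₛ≡zer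
    U-coefficients : ∀ {v} → v ∈ U → g v ≡ zer
    U-coefficients v∈U with ∈U-view v∈U
    ... | sum = gₛ≡zer
    ... | unit k = proj₁ (unit-coefficient k)

  misses-U⇒dissociated : Unique T → T ⊆ A → u ∈ U → u ∉ T → Dissociated T
  misses-U⇒dissociated {T} T-unique T⊆A u∈U u∉T ε ε-rel {t} t∈T =
    trans (sym (mask-∈ t∈T)) (vanishes-on-A (T⊆A t∈T))
    where
    ε̂ : Pt n → Coef
    ε̂ = mask T ε
    ε̂-rep : comb ε̂ A ≡ dbl 0ᵥ
    ε̂-rep = trans (comb-mask T-unique A-unique T⊆A) (trans ε-rel (sym (·ᵥ-zeroʳ (+ 2))))
    split : (∀ {v} → v ∈ U → ε̂ v ≡ zer) × comb (ε̂ ∘ dbl) D ≡ 0ᵥ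
    split = even-representation ε̂ ε̂-rep u∈U (mask-∉ u∉T)
    vanishes-on-A : z ∈ A → ε̂ z ≡ zer
    vanishes-on-A z∈A with ∈A⁻ z∈A
    ... | inj₁ z∈U = proj₁ split z∈U
    ... | inj₂ z∈D₂ with ∈P.∈-map⁻ dbl z∈D₂
    ...   | x , x∈D , refl = D-dissociated (ε̂ ∘ dbl) (proj₂ split) x∈D

  -- Coefficients of 2x = s + Σ (2xᵢ − 1) eᵢ; the coordinate xᵢ is read off as dot x (e i).
  dbl-coef : Pt n → Pt n → Coef
  dbl-coef x z with z ≟ᵥ s
  ... | yes _ = pos
  ... | no _ with dot x z ℤ.≟ + 1
  ...   | yes _ = pos
  ...   | no _ = neg

  dbl-coef-s : (x : Pt n) → dbl-coef x s ≡ pos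
  dbl-coef-s x with s ≟ᵥ s
  ... | yes _ = refl
  ... | no s≢s = contradiction refl s≢s

  dbl-coef-e : ZeroOne x → (k : Fin n) → ⟦ dbl-coef x (e k) ⟧ ℤ.+ + 1 ≡ + 2 ℤ.* lookup x k
  dbl-coef-e {x} x-bits k with e k ≟ᵥ s
  ... | yes eₖ≡s = contradiction (subst (_∈ basis n) eₖ≡s (∈-basis⁺ k)) s∉basis
  ... | no _ with dot x (e k) ℤ.≟ + 1
  ...   | yes xₖ≡1 = cong (ℤ._*_ (+ 2)) (sym (trans (sym (dot-e x k)) xₖ≡1))
  ...   | no xₖ≢1 =
    cong (ℤ._*_ (+ 2)) (sym (bit≢1⇒0 (VecAllP.lookup⁺ x-bits k) (xₖ≢1 ∘ trans (dot-e x k))))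

  comb-dbl-coef : ZeroOne x → comb (dbl-coef x) U ≡ dbl x
  comb-dbl-coef {x} x-bits = ≡-by-lookup _ _ λ k → begin
    lookup (comb (dbl-coef x) U) k
      ≡⟨ lookup-comb-U (dbl-coef x) k ⟩
    ⟦ dbl-coef x (e k) ⟧ ℤ.+ ⟦ dbl-coef x s ⟧
      ≡⟨ cong (λ a → ⟦ dbl-coef x (e k) ⟧ ℤ.+ ⟦ a ⟧) (dbl-coef-s x) ⟩
    ⟦ dbl-coef x (e k) ⟧ ℤ.+ + 1
      ≡⟨ dbl-coef-e x-bits k ⟩
    + 2 ℤ.* lookup x k
      ≡⟨ lookup-dbl x k ⟨
    lookup (dbl x) k ∎

  ⊇U⇒¬dissociated : Unique T → U ⊆ T → ¬ Dissociated T
  ⊇U⇒¬dissociated {T} T-unique U⊆T T-dissociated =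
    pos≢zer (trans (sym ρₛ≡pos) (T-dissociated ρ ρ-rel (U⊆T s∈U)))
    where
    ρ : Pt n → Coef
    ρ = mask U (dbl-coef 0ᵥ)
    ρ-rel : comb ρ T ≡ 0ᵥ
    ρ-rel = trans (comb-mask U-unique T-unique U⊆T)
                  (trans (comb-dbl-coef 0ᵥ-bits) (·ᵥ-zeroʳ (+ 2)))
    ρₛ≡pos : ρ s ≡ pos
    ρₛ≡pos = trans (mask-∈ s∈U) (dbl-coef-s 0ᵥ)
    pos≢zer : pos ≢ zer
    pos≢zer ()

  U⊆-or-misses : (T : List (Pt n)) → U ⊆ T ⊎ ∃ λ u → u ∈ U × u ∉ T
  U⊆-or-misses T with All.all? (_∈? T) U
  ... | yes U⊆T = inj₁ (All.lookup U⊆T)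
  ... | no U⊈T = inj₂ (find (¬All⇒Any¬ (_∈? T) U U⊈T))

  dissociated⇒misses-U : Unique T → Dissociated T → ∃ λ u → u ∈ U × u ∉ T
  dissociated⇒misses-U {T} T-unique T-dissociated with U⊆-or-misses T
  ... | inj₁ U⊆T = ⊥-elim (⊇U⇒¬dissociated T-unique U⊆T T-dissociated)
  ... | inj₂ missed = missed

  A─u-dissociated : u ∈ U → Dissociated (A ─ u)
  A─u-dissociated u∈U =
    misses-U⇒dissociated (proj₁ A─u-subset) (proj₂ A─u-subset) u∈U
      (λ p → proj₂ (∈-─⁻ {L = A} p) refl)

  A─u-maximal : u ∈ U → MaximalDissociated A (A ─ u)
  A─u-maximal {u} u∈U = A─u-subset , A─u-dissociated u∈U , maximal
    where
    maximal : ∀ T → SubsetOf A T → Dissociated T → (A ─ u) ⊆ T → T ⊆ (A ─ u)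
    maximal T (T-unique , T⊆A) T-dissociated A─u⊆T
      with dissociated⇒misses-U T-unique T-dissociated
    ... | v , v∈U , v∉T with v ≟ᵥ u
    ...   | yes refl = ⊆-─ T⊆A v∉T
    ...   | no v≢u = contradiction (A─u⊆T (∈-─⁺ (U⊆A v∈U) v≢u)) v∉T

  ddIs : DdIs A (n + length D)
  ddIs = (A ─ s , A─u-subset , A─u-dissociated s∈U , length-A─u s∈U) , upper
    where
    upper : ∀ T → SubsetOf A T → Dissociated T → length T ≤ n + length D
    upper T (T-unique , T⊆A) T-dissociated with dissociated⇒misses-U T-unique T-dissociated
    ... | u , u∈U , u∉T = subst (length T ≤_) (length-A─u u∈U)
      (⊆⇒length≤ T-unique (proj₁ A─u-subset) (⊆-─ T⊆A u∉T))

  ddMinusIs : DdMinusIs A (n + length D)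
  ddMinusIs = (A ─ s , A─u-maximal s∈U , length-A─u s∈U) , lower
    where
    lower : ∀ T → MaximalDissociated A T → n + length D ≤ length T
    lower T ((T-unique , T⊆A) , T-dissociated , maximal)
      with dissociated⇒misses-U T-unique T-dissociated
    ... | u , u∈U , u∉T = subst (_≤ length T) (length-A─u u∈U)
      (⊆⇒length≤ (proj₁ A─u-subset) T-unique
        (maximal (A ─ u) A─u-subset (A─u-dissociated u∈U) (⊆-─ T⊆A u∉T)))

  U-spans : Spans U A
  U-spans y∈A with ∈A⁻ y∈A
  ... | inj₁ y∈U = ∈⇒∈⟨⟩ U-unique y∈U
  ... | inj₂ y∈D₂ with ∈P.∈-map⁻ dbl y∈D₂
  ...   | x , x∈D , refl = dbl-coef x , comb-dbl-coef (All.lookup D-bits x∈D)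

  unit-needed : Unique S → S ⊆ A → e i ∉ S → InU v → v ≢ e i → v ∉ S →
    ¬ (e i ∈⟨ S ⟩)
  unit-needed {S} {i} S-unique S⊆A eᵢ∉S v-view v≢eᵢ v∉S (f , f-rep) =
    parity-odd _ _ _ (trans (coordinates f̂ f̂-rep i) (e-diagonal i)) (mask-∉ eᵢ∉S)
      (from-view v-view v≢eᵢ (mask-∉ v∉S))
    where
    f̂ : Pt n → Coef
    f̂ = mask S f
    f̂-rep : comb f̂ A ≡ e i
    f̂-rep = trans (comb-mask S-unique A-unique S⊆A) f-rep
    from-view : InU w → w ≢ e i → f̂ w ≡ zer → f̂ s ≡ zer
    from-view sum _ f̂ₛ≡zer = f̂ₛ≡zer
    from-view (unit j) eⱼ≢eᵢ f̂ⱼ≡zer =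
      s-coefficient-zero {t = + 0} f̂ f̂-rep f̂ⱼ≡zer (e-offdiagonal (eⱼ≢eᵢ ∘ cong e ∘ sym))

  spanning-misses-at-most-one : Unique S → S ⊆ A → Spans S A →
    u ∈ U → u ∉ S → v ∈ U → v ≢ u → v ∈ S
  spanning-misses-at-most-one {S} {u} {v} S-unique S⊆A S-spans u∈U u∉S v∈U v≢u
    with v ∈? S
  ... | yes v∈S = v∈S
  ... | no v∉S = ⊥-elim (one-is-a-unit (∈U-view u∈U) (∈U-view v∈U) v≢u u∉S v∉S)
    where
    one-is-a-unit : InU x → InU y → y ≢ x → x ∉ S → y ∉ S → ⊥
    one-is-a-unit sum sum s≢s _ _ = s≢s refl
    one-is-a-unit sum (unit i) eᵢ≢s s∉S eᵢ∉S =
      unit-needed S-unique S⊆A eᵢ∉S sum (≢-sym eᵢ≢s) s∉S (S-spans (U⊆A (e∈U i)))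
    one-is-a-unit (unit i) y-view y≢eᵢ eᵢ∉S y∉S =
      unit-needed S-unique S⊆A eᵢ∉S y-view y≢eᵢ y∉S (S-spans (U⊆A (e∈U i)))

  doubles-needed : Unique S → S ⊆ A → u ∈ U → u ∉ S → (∀ {z} → z ∈ S → z ∉ D₂) →
    ¬ (dbl x₀ ∈⟨ S ⟩)
  doubles-needed {S} S-unique S⊆A u∈U u∉S S∩D₂≡∅ (f , f-rep) =
    0ᵥ∉dissociated D-unique D-dissociated (subst (_∈ D) x₀≡0ᵥ x₀∈D)
    where
    f̂ : Pt n → Coef
    f̂ = mask S f
    f̂-rep : comb f̂ A ≡ dbl x₀
    f̂-rep = trans (comb-mask S-unique A-unique S⊆A) f-rep
    x₀≡0ᵥ : x₀ ≡ 0ᵥ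
    x₀≡0ᵥ = begin
      x₀                ≡⟨ proj₂ (even-representation f̂ f̂-rep u∈U (mask-∉ u∉S)) ⟨
      comb (f̂ ∘ dbl) D  ≡⟨ comb-zer (λ x∈D → mask-∉ (λ 2x∈S → S∩D₂≡∅ 2x∈S (∈P.∈-map⁺ dbl x∈D))) ⟩
      0ᵥ                ∎

  spanning-lower-bound : ∀ S → SubsetOf A S → Spans S A → n + 1 ≤ length S
  spanning-lower-bound S (S-unique , S⊆A) S-spans with U⊆-or-misses S
  ... | inj₁ U⊆S = subst (_≤ length S) length-U (⊆⇒length≤ U-unique S-unique U⊆S)
  ... | inj₂ (u , u∈U , u∉S) with Any.any? (_∈? D₂) S
  ...   | no S∩D₂≡∅ = ⊥-elim (doubles-needed S-unique S⊆A u∈U u∉S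
    (λ z∈S z∈D₂ → S∩D₂≡∅ (lose z∈S z∈D₂)) (S-spans (dbl∈A x₀∈D)))
  ...   | yes S∩D₂ with find S∩D₂
  ...     | z , z∈S , z∈D₂ = subst (_≤ length S) (trans (length-─ U-unique u∈U) length-U)
    (⊆⇒length≤ z∷U─u-unique S-unique z∷U─u⊆S)
    where
    z∉U : z ∉ U
    z∉U with ∈P.∈-map⁻ dbl z∈D₂
    ... | x , x∈D , refl = dbl∉U x∈D
    z∷U─u-unique : Unique (z ∷ U ─ u)
    z∷U─u-unique = ¬Any⇒All¬ _ (λ p → z∉U (proj₁ (∈-─⁻ p))) ∷ ─-unique U-unique
    z∷U─u⊆S : (z ∷ U ─ u) ⊆ S
    z∷U─u⊆S (here refl) = z∈S
    z∷U─u⊆S (there p) with ∈-─⁻ p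
    ... | v∈U , v≢u = spanning-misses-at-most-one S-unique S⊆A S-spans u∈U u∉S v∈U v≢u

  dsIs : DsIs A (n + 1)
  dsIs = (U , (U-unique , U⊆A) , U-spans , length-U) , spanning-lower-bound

-- The case n = 1

module Dimension1 where

  one two : Pt 1
  one = + 1 ∷ Vec.[]
  two = + 2 ∷ Vec.[]

  bits≢0ᵥ⇒one : ZeroOne x → x ≢ 0ᵥ → x ≡ one
  bits≢0ᵥ⇒one (b0 VecAll.∷ VecAll.[]) x≢0ᵥ = contradiction refl x≢0ᵥ
  bits≢0ᵥ⇒one (b1 VecAll.∷ VecAll.[]) _ = refl

  D≡one : {D : List (Pt 1)} → Unique D → All ZeroOne D → Dissociated D → D ≢ [] →
    D ≡ one ∷ []
  D≡one {D} D-unique D-bits D-dissociated D≢[] = shape D D-unique D≢[] (λ x∈D → x∈D)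
    where
    is-one : x ∈ D → x ≡ one
    is-one x∈D = bits≢0ᵥ⇒one (All.lookup D-bits x∈D)
      (λ { refl → 0ᵥ∉dissociated D-unique D-dissociated x∈D })
    shape : (T : List (Pt 1)) → Unique T → T ≢ [] → T ⊆ D → T ≡ one ∷ []
    shape [] _ []≢[] _ = contradiction refl []≢[]
    shape (x ∷ []) _ _ T⊆D = cong (_∷ []) (is-one (T⊆D (here refl)))
    shape (x ∷ y ∷ _) ((x≢y ∷ _) ∷ _) _ T⊆D =
      ⊥-elim (x≢y (trans (is-one (T⊆D (here refl))) (sym (is-one (T⊆D (there (here refl)))))))

  -- Aset 1 (one ∷ []) reduces to one ∷ one ∷ two ∷ [], since e zero = s₁ = one.
  A : List (Pt 1)
  A = Aset 1 (one ∷ [])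

  A′ : List (Pt 1)
  A′ = one ∷ two ∷ []

  A′-unique : Unique A′
  A′-unique = ((λ ()) ∷ []) ∷ [] ∷ []

  A′⊆A : A′ ⊆ A
  A′⊆A (here refl) = here refl
  A′⊆A (there (here refl)) = there (there (here refl))

  A⊆A′ : A ⊆ A′
  A⊆A′ (here refl) = here refl
  A⊆A′ (there (here refl)) = here refl
  A⊆A′ (there (there p)) = there p

  one-two-relation : ∀ a b → (⟦ a ⟧ ·ᵥ one) +ᵥ ((⟦ b ⟧ ·ᵥ two) +ᵥ 0ᵥ) ≡ 0ᵥ → a ≡ zer × b ≡ zer
  one-two-relation zer zer _ = refl , refl
  one-two-relation zer pos ()
  one-two-relation zer neg ()
  one-two-relation pos zer ()
  one-two-relation pos pos ()
  one-two-relation pos neg ()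
  one-two-relation neg zer ()
  one-two-relation neg pos ()
  one-two-relation neg neg ()

  A′-dissociated : Dissociated A′
  A′-dissociated ε ε-rel (here refl) = proj₁ (one-two-relation (ε one) (ε two) ε-rel)
  A′-dissociated ε ε-rel (there (here refl)) = proj₂ (one-two-relation (ε one) (ε two) ε-rel)

  A′-spans : Spans A′ A
  A′-spans y∈A = ∈⇒∈⟨⟩ A′-unique (A⊆A′ y∈A)

  two∉⟨one⟩ : ∀ a → (⟦ a ⟧ ·ᵥ one) +ᵥ 0ᵥ ≢ two
  two∉⟨one⟩ zer ()
  two∉⟨one⟩ pos ()
  two∉⟨one⟩ neg ()

  one∉⟨two⟩ : ∀ a → (⟦ a ⟧ ·ᵥ two) +ᵥ 0ᵥ ≢ one
  one∉⟨two⟩ zer ()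
  one∉⟨two⟩ pos ()
  one∉⟨two⟩ neg ()

  spanning-lower-bound : ∀ S → SubsetOf A S → Spans S A → 2 ≤ length S
  spanning-lower-bound [] _ S-spans with S-spans (here refl)
  ... | _ , ()
  spanning-lower-bound (z ∷ []) (_ , S⊆A) S-spans with A⊆A′ (S⊆A (here refl))
  ... | here refl =
    let (f , f-rep) = S-spans (A′⊆A (there (here refl))) in ⊥-elim (two∉⟨one⟩ (f one) f-rep)
  ... | there (here refl) =
    let (f , f-rep) = S-spans (A′⊆A (here refl)) in ⊥-elim (one∉⟨two⟩ (f two) f-rep)
  spanning-lower-bound (_ ∷ _ ∷ _) _ _ = s≤s (s≤s z≤n)

  dsIs : DsIs A 2
  dsIs = (A′ , (A′-unique , A′⊆A) , A′-spans , refl) , spanning-lower-bound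

  ddIs : DdIs A 2
  ddIs = (A′ , (A′-unique , A′⊆A) , A′-dissociated , refl) ,
    λ T (T-unique , T⊆A) _ → ⊆⇒length≤ T-unique A′-unique (λ p → A⊆A′ (T⊆A p))

  ddMinusIs : DdMinusIs A 2
  ddMinusIs =
    (A′ , ((A′-unique , A′⊆A) , A′-dissociated , λ _ (_ , T⊆A) _ _ p → A⊆A′ (T⊆A p)) , refl) ,
    λ T ((T-unique , T⊆A) , _ , maximal) → ⊆⇒length≤ A′-unique T-unique
      (maximal A′ (A′-unique , A′⊆A) A′-dissociated (λ p → A⊆A′ (T⊆A p)))

proposition2p3 : (n : ℕ) → .{{_ : NonZero n}} → (D : List (Pt n)) →
    Unique D → D ≢ [] → All ZeroOne D → Dissociated D →
    DsIs (Aset n D) (n + 1) × DdMinusIs (Aset n D) (n + length D) × DdIs (Aset n D) (n + length D)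
proposition2p3 zero {{()}}
proposition2p3 1 D D-unique D≢[] D-bits D-dissociated
  rewrite Dimension1.D≡one D-unique D-bits D-dissociated D≢[] = dsIs , ddMinusIs , ddIs
  where open Dimension1
proposition2p3 (suc (suc _)) [] _ []≢[] _ _ = contradiction refl []≢[]
proposition2p3 (suc (suc _)) (x₀ ∷ D) D-unique _ D-bits D-dissociated = dsIs , ddMinusIs , ddIs
  where open Dimension≥2 Fin.zero (Fin.suc Fin.zero) (λ ()) D-unique D-bits D-dissociated (here refl)
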